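{- Let $\mathcal{P}$ be a well-formed tail-recursive integer program and let $\alpha_1,\alpha_2\in\mathcal{P}$ with \[ \alpha_1: f_1(\vec x)\xrightarrow{c_1}f_2(\vec x)\mu\ [\varphi_1],\qquad \alpha_2: f_2(\vec x)\xrightarrow{c_2}t\ [\varphi_2], \] where $\mathcal{TV}(\alpha_1)\cap\mathcal{TV}(\alpha_2)=\emptyset$. Let $\alpha_{1.2}$ be the rule $f_1(\vec x)\xrightarrow{c_1+c_2\mu}t\mu\ [\varphi_1\land\varphi_2\mu]$ and $\mathcal{P}'=\mathcal{P}\cup\{\alpha_{1.2}\}$. Then $\mathcal{P}'$ is well formed and the processor mapping $\mathcal{P}$ to $\mathcal{P}'$ is sound.
   Context: Fix a finite set $\Sigma$ of function symbols of common arity $k$ containing a start symbol $f_0$, and variables ranging over $\mathbb{Z}$. Arithmetic expressions are built from variables, numbers and operations such as $+,-,\cdot$, division, exponentiation; a constraint is a finite conjunction of inequations between arithmetic expressions. A rule has the form $f(\vec x)\xrightarrow{c}T\ [\varphi]$ where $\vec x=(x_1,\dots,x_k)$ is a fixed vector of pairwise different program variables, $f\in\Sigma$, $c$ is an arithmetic expression (cost), $T$ a finite multiset of terms $g(t_1,\dots,t_k)$ ($g\in\Sigma$, $t_i$ arithmetic expressions), and $\varphi$ a constraint (guard); a single term $t$ on a right-hand side stands for $\{t\}$. $\mathcal{TV}(\alpha)$ denotes the variables of $\alpha$ not in $\vec x$ (temporary variables). An integer program is a finite set of rules in which $f_0$ does not occur on right-hand sides; it is tail-recursive if every right-hand side has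 at most one element. Substitutions map variables to arithmetic expressions, applied homomorphically ($t\mu$); $f_2(\vec x)\mu$ is the term $f_2(x_1\mu,\dots,x_k\mu)$. An integer substitution maps variables of its domain to integers; $\sigma\models\alpha$ means all variables of $\alpha$ lie in $\mathrm{dom}(\sigma)$ and $\sigma$ models the guard. A configuration is a finite multiset of terms $f(n_1,\dots,n_k)$, $n_i\in\mathbb{Z}$. $S\xrightarrow{k}_{\mathcal{P}}T$ if there are $s\in S$, a rule $f(\vec x)\xrightarrow{c}Q\ [\varphi]$ in $\mathcal{P}$ and an integer substitution $\sigma$ covering the rule's variables with $f(\vec x)\sigma=s$, $\sigma\models\varphi$, $c\sigma=k$, $T=(S\setminus\{s\})\cup Q\sigma$ (equality modulo arithmetic); costs of sequences are summed. $\mathrm{dh}_{\mathcal{P}}(S)=\sup\{k\mid S\xrightarrow{k}{}^{*}_{\mathcal{P}}T\}$, $\mathrm{rc}_{\mathcal{P}}(n)=\sup\{\mathrm{dh}_{\mathcal{P}}(f_0(\vec n))\mid\vec n\in\mathbb{Z}^k,\sum_i|n_i|\leq n\}$. A rule $\alpha$ is well formed if $t_i\sigma\in\mathbb{Z}$ for all $f(t_1,\dots,t_k)\in\mathrm{rhs}(\alpha)$, all $i$ and all integer substitutions $\sigma\models\alpha$; a program is well formed if all its rules are. A processor is a partial function on integer programs; it is sound if $\mathrm{rc}_{\mathcal{P}}(n)\geq\mathrm{rc}_{\mathrm{proc}(\mathcal{P})}(n)$ for all $n\in\mathbb{N}$ and all $\mathcal{P}$ where it is defined. -}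

module Defs where

open import Data.Nat as ℕ using (ℕ; zero; suc)
open import Data.Integer as ℤ using (ℤ; +_; -[1+_]; ∣_∣)
open import Data.Rational as ℚ using (ℚ; 0ℚ; 1ℚ; _/_; _÷_; 1/_; ≢-nonZero)
open import Data.Rational.Properties using (_≟_)
open import Data.Fin using (Fin)
open import Data.Vec as Vec using (Vec; lookup; tabulate)
open import Data.List as List using (List; []; _∷_; _++_; length)
open import Data.List.Relation.Unary.All using (All)
open import Data.List.Relation.Unary.Any using (Any)
open import Data.List.Membership.Propositional using (_∈_)
open import Data.List.Relation.Binary.Permutation.Propositional using (_↭_)
open import Data.List.Relation.Binary.Pointwise using (Pointwise)
open import Data.Maybe using (Maybe; just; nothing)
open import Data.Sum using (_⊎_; inj₁; inj₂)
open import Data.Product using (Σ; ∃; _×_; _,_; proj₁; proj₂)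
open import Relation.Nullary using (¬_; yes; no)
open import Relation.Binary.PropositionalEquality using (_≡_; _≢_)

private variable
  m k : ℕ

-- Variables: program variables x₁..x_k are  inj₁ i  (i : Fin k);
-- all other variables (potential temporary variables) are  inj₂ j  (j : ℕ).

Var : ℕ → Set
Var k = Fin k ⊎ ℕ

x : Fin k → Var k
x i = inj₁ i

infixl 6 _⊕_ _⊖_
infixl 7 _⊗_ _⊘_
infixr 8 _⊛_

data Exp (k : ℕ) : Set where
  var  : Var k → Exp k
  num  : ℤ → Exp k
  _⊕_  : Exp k → Exp k → Exp k
  _⊖_  : Exp k → Exp k → Exp k
  _⊗_  : Exp k → Exp k → Exp k
  _⊘_  : Exp k → Exp k → Exp k
  _⊛_  : Exp k → Exp k → Exp k

ι : ℤ → ℚ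
ι z = z / 1

pow : ℚ → ℕ → ℚ
pow b zero    = 1ℚ
pow b (suc n) = b ℚ.* pow b n

IntSubst : ℕ → Set
IntSubst k = Var k → ℤ

-- Evaluation; 'nothing' = undefined (division by 0, 0 to a negative power,
-- non-integral exponent).
safeDiv : ℚ → ℚ → Maybe ℚ
safeDiv p q with q ≟ 0ℚ
... | yes _ = nothing
... | no q≢0 = just ((p ÷ q) {{≢-nonZero q≢0}})

powℤ : ℚ → ℤ → Maybe ℚ
powℤ b (+ n) = just (pow b n)
powℤ b -[1+ n ] with pow b (suc n) ≟ 0ℚ
... | yes _ = nothing
... | no ne = just ((1/ pow b (suc n)) {{≢-nonZero ne}})

safePow : ℚ → ℚ → Maybe ℚ
safePow b e with ℚ.denominatorℕ e ℕ.≟ 1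
... | yes _ = powℤ b (ℚ.numerator e)
... | no _  = nothing

eval : Exp k → IntSubst k → Maybe ℚ
eval (var v) σ = just (ι (σ v))
eval (num z) σ = just (ι z)
eval (a ⊕ b) σ with eval a σ | eval b σ
... | just p | just q = just (p ℚ.+ q)
... | _      | _      = nothing
eval (a ⊖ b) σ with eval a σ | eval b σ
... | just p | just q = just (p ℚ.- q)
... | _      | _      = nothing
eval (a ⊗ b) σ with eval a σ | eval b σ
... | just p | just q = just (p ℚ.* q)
... | _      | _      = nothing
eval (a ⊘ b) σ with eval a σ | eval b σ
... | just p | just q = safeDiv p q
... | _      | _      = nothing
eval (a ⊛ b) σ with eval a σ | eval b σ
... | just p | just q = safePow p q
... | _      | _      = nothing

IsInt : Maybe ℚ → Set
IsInt r = ∃ λ z → r ≡ just (ι z)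

data RelOp : Set where
  `<` `≤` `=` `≠` `≥` `>` : RelOp

holdsOp : RelOp → ℚ → ℚ → Set
holdsOp `<` p q = p ℚ.< q
holdsOp `≤` p q = p ℚ.≤ q
holdsOp `=` p q = p ≡ q
holdsOp `≠` p q = p ≢ q
holdsOp `≥` p q = p ℚ.≥ q
holdsOp `>` p q = p ℚ.> q

record Ineq (k : ℕ) : Set where
  constructor ineq
  field
    left  : Exp k
    op    : RelOp
    right : Exp k

Constraint : ℕ → Set
Constraint k = List (Ineq k)

HoldsIneq : IntSubst k → Ineq k → Set
HoldsIneq σ (ineq a o b) = ∃ λ p → ∃ λ q → eval a σ ≡ just p × eval b σ ≡ just q × holdsOp o p q

_⊨_ : IntSubst k → Constraint k → Set
σ ⊨ φ = All (HoldsIneq σ) φ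

-- Terms with expression arguments, rules, programs
-- Function symbols: Σ = Fin m (a finite set), common arity k.

Term : ℕ → ℕ → Set
Term m k = Fin m × Vec (Exp k) k

record Rule (m k : ℕ) : Set where
  constructor rule
  field
    lhsSym : Fin m            -- left-hand side is  lhsSym(x₁,…,x_k)
    cost   : Exp k
    rhs    : List (Term m k)  -- finite multiset of terms
    guard  : Constraint k
open Rule public

Program : ℕ → ℕ → Set
Program m k = List (Rule m k)

IsIntegerProgram : Fin m → Program m k → Set
IsIntegerProgram f0 P = All (λ α → All (λ t → proj₁ t ≢ f0) (rhs α)) P

TailRecursive : Program m k → Set
TailRecursive P = All (λ α → length (rhs α) ℕ.≤ 1) P

data OccursIn {k} (v : Var k) : Exp k → Set where
  here : OccursIn v (var v)
  ⊕ˡ : ∀ {a b} → OccursIn v a → OccursIn v (a ⊕ b)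
  ⊕ʳ : ∀ {a b} → OccursIn v b → OccursIn v (a ⊕ b)
  ⊖ˡ : ∀ {a b} → OccursIn v a → OccursIn v (a ⊖ b)
  ⊖ʳ : ∀ {a b} → OccursIn v b → OccursIn v (a ⊖ b)
  ⊗ˡ : ∀ {a b} → OccursIn v a → OccursIn v (a ⊗ b)
  ⊗ʳ : ∀ {a b} → OccursIn v b → OccursIn v (a ⊗ b)
  ⊘ˡ : ∀ {a b} → OccursIn v a → OccursIn v (a ⊘ b)
  ⊘ʳ : ∀ {a b} → OccursIn v b → OccursIn v (a ⊘ b)
  ⊛ˡ : ∀ {a b} → OccursIn v a → OccursIn v (a ⊛ b)
  ⊛ʳ : ∀ {a b} → OccursIn v b → OccursIn v (a ⊛ b)

-- v occurs in the rule α (lhs only contains program variables)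
OccursInRule : Var k → Rule m k → Set
OccursInRule v α =
    OccursIn v (cost α)
  ⊎ Any (λ t → ∃ λ i → OccursIn v (lookup (proj₂ t) i)) (rhs α)
  ⊎ Any (λ c → OccursIn v (Ineq.left c) ⊎ OccursIn v (Ineq.right c)) (guard α)

InTV : Rule m k → ℕ → Set
InTV α j = OccursInRule (inj₂ j) α

-- Substitutions with domain x⃗:  μ(x_i) = μ i, identity on other variables.

PSubst : ℕ → Set
PSubst k = Fin k → Exp k

_⟪_⟫ : Exp k → PSubst k → Exp k
var (inj₁ i) ⟪ μ ⟫ = μ i
var (inj₂ j) ⟪ μ ⟫ = var (inj₂ j)
num z   ⟪ μ ⟫ = num z
(a ⊕ b) ⟪ μ ⟫ = a ⟪ μ ⟫ ⊕ b ⟪ μ ⟫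
(a ⊖ b) ⟪ μ ⟫ = a ⟪ μ ⟫ ⊖ b ⟪ μ ⟫
(a ⊗ b) ⟪ μ ⟫ = a ⟪ μ ⟫ ⊗ b ⟪ μ ⟫
(a ⊘ b) ⟪ μ ⟫ = a ⟪ μ ⟫ ⊘ b ⟪ μ ⟫
(a ⊛ b) ⟪ μ ⟫ = a ⟪ μ ⟫ ⊛ b ⟪ μ ⟫

substTerm : Term m k → PSubst k → Term m k
substTerm (g , ts) μ = g , Vec.map (_⟪ μ ⟫) ts

substIneq : Ineq k → PSubst k → Ineq k
substIneq (ineq a o b) μ = ineq (a ⟪ μ ⟫) o (b ⟪ μ ⟫)

substConstraint : Constraint k → PSubst k → Constraint k
substConstraint φ μ = List.map (λ c → substIneq c μ) φ

applyLhs : Fin m → PSubst k → Term m k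
applyLhs f μ = f , tabulate μ

chain : Fin m → Exp k → Constraint k → PSubst k → Exp k → Term m k → Constraint k → Rule m k
chain f1 c1 φ1 μ c2 t φ2 = rule f1 (c1 ⊕ (c2 ⟪ μ ⟫)) (substTerm t μ ∷ []) (φ1 ++ substConstraint φ2 μ)

-- σ ⊨ α : σ covers all variables (automatic: σ is total) and σ models the guard
WellFormedRule : Rule m k → Set
WellFormedRule {k = k} α =
  (σ : IntSubst k) → σ ⊨ guard α →
  All (λ t → (i : Fin k) → IsInt (eval (lookup (proj₂ t) i) σ)) (rhs α)

WellFormed : Program m k → Set
WellFormed P = All WellFormedRule P

CTerm : ℕ → ℕ → Set
CTerm m k = Fin m × Vec ℤ k

Config : ℕ → ℕ → Set
Config m k = List (CTerm m k)   -- finite multiset (up to permutation ↭)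

EvalTerm : IntSubst k → Term m k → CTerm m k → Set
EvalTerm {k = k} σ (g , ts) (h , ns) = g ≡ h × ((i : Fin k) → eval (lookup ts i) σ ≡ just (ι (lookup ns i)))

data Step {m k} (P : Program m k) : Config m k → ℚ → Config m k → Set where
  step : ∀ {S S′ T α σ ns q Qv} →
         α ∈ P →
         S ↭ ((lhsSym α , ns) ∷ S′) →                 -- s = f(x⃗)σ ∈ S
         ((i : Fin k) → σ (x i) ≡ lookup ns i) →
         σ ⊨ guard α →
         eval (cost α) σ ≡ just q →
         Pointwise (EvalTerm σ) (rhs α) Qv →
         T ↭ (Qv ++ S′) →                               -- T = (S ∖ {s}) ∪ Qσ
         Step P S q T

data Steps {m k} (P : Program m k) : Config m k → ℚ → Config m k → Set where
  done : ∀ {S} → Steps P S 0ℚ S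
  more : ∀ {S S′ T q r} → Step P S q S′ → Steps P S′ r T → Steps P S (q ℚ.+ r) T

norm : Vec ℤ k → ℕ
norm ns = Vec.foldr _ (λ z acc → ∣ z ∣ ℕ.+ acc) 0 ns

-- costs of derivations from some f₀(n⃗) with Σ|n_i| ≤ n; rc_P(n) is the
-- supremum (in ℝ ∪ {±∞}) of this set (sup of the sups dh_P(f₀(n⃗))).
RcCosts : Fin m → Program m k → ℕ → ℚ → Set
RcCosts {m} {k} f0 P n q =
  Σ (Vec ℤ k) λ ns → norm ns ℕ.≤ n × ∃ λ (T : Config m k) → Steps P ((f0 , ns) ∷ []) q T

-- sup A ≤ sup B  (suprema in the extended reals), written out
_≤sup_ : (ℚ → Set) → (ℚ → Set) → Set
A ≤sup B = ∀ a → A a → ∀ q → q ℚ.< a → ∃ λ b → B b × q ℚ.< b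

SoundFor : Fin m → Program m k → Program m k → Set
SoundFor f0 P P′ = ∀ n → RcCosts f0 P′ n ≤sup RcCosts f0 P n

module Submission where

-- The key notion is the composite of a substitution μ with an integer
-- substitution σ: an integer substitution σ′ sending xᵢ to the value of μ(xᵢ)
-- under σ and agreeing with σ on temporary variables.  The substitution
-- lemma says that evaluating eμ under σ is evaluating e under σ′; it lifts to
-- guards and to right-hand sides.  If σ satisfies φ₁, well-formedness of α₁
-- makes every μ(xᵢ)σ an integer, so the composite exists.
--
-- Well-formedness of α₁.₂ then follows from that of α₂ under σ′.  For
-- soundness, one α₁.₂-step under σ is replayed as an α₁-step under σ and an
-- α₂-step under σ′ with the same total cost; since every step of P ∪ {α₁.₂}
-- is thus a derivation of P, every derivation is, and the sets of costs
-- bounding rc only shrink.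

open import Defs
open import Data.Nat using (ℕ)
open import Data.Fin using (Fin)
open import Data.Product using (_×_; Σ; ∃; _,_; proj₁; proj₂)
open import Data.Sum using (inj₁; inj₂)
open import Data.Maybe using (Maybe; just; nothing)
open import Data.Rational as ℚ using (ℚ)
import Data.Rational.Properties as ℚP
open import Data.Vec using (lookup; tabulate)
open import Data.Vec.Properties using (lookup∘tabulate; lookup-map)
open import Data.List using ([]; _∷_)
open import Data.List.Membership.Propositional using (_∈_)
open import Data.List.Relation.Unary.All as All using ([]; _∷_)
open import Data.List.Relation.Unary.All.Properties using (++⁻)
open import Data.List.Relation.Unary.Any using (here; there)
open import Data.List.Relation.Binary.Pointwise using ([]; _∷_)
open import Data.List.Relation.Binary.Permutation.Propositional using (↭-refl)
open import Relation.Nullary using (¬_)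
open import Relation.Binary.PropositionalEquality
  using (_≡_; refl; sym; trans; cong; cong₂; subst; module ≡-Reasoning)

private variable
  m k : ℕ

-- Evaluation is compositional.  The five binary expression constructors are
-- named by 'BinOp' so that the facts below are stated once for all of them.

data BinOp : Set where
  add sub mul div exp : BinOp

binExp : BinOp → Exp k → Exp k → Exp k
binExp add a b = a ⊕ b
binExp sub a b = a ⊖ b
binExp mul a b = a ⊗ b
binExp div a b = a ⊘ b
binExp exp a b = a ⊛ b

binVal : BinOp → ℚ → ℚ → Maybe ℚ
binVal add p q = just (p ℚ.+ q)
binVal sub p q = just (p ℚ.- q)
binVal mul p q = just (p ℚ.* q)
binVal div p q = safeDiv p q
binVal exp p q = safePow p q

both : (ℚ → ℚ → Maybe ℚ) → Maybe ℚ → Maybe ℚ → Maybe ℚ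
both f (just p) (just q) = f p q
both f _        _        = nothing

eval-bin : ∀ o (a b : Exp k) σ → eval (binExp o a b) σ ≡ both (binVal o) (eval a σ) (eval b σ)
eval-bin add a b σ with eval a σ | eval b σ
... | just _  | just _  = refl
... | just _  | nothing = refl
... | nothing | _       = refl
eval-bin sub a b σ with eval a σ | eval b σ
... | just _  | just _  = refl
... | just _  | nothing = refl
... | nothing | _       = refl
eval-bin mul a b σ with eval a σ | eval b σ
... | just _  | just _  = refl
... | just _  | nothing = refl
... | nothing | _       = refl
eval-bin div a b σ with eval a σ | eval b σ
... | just _  | just _  = refl
... | just _  | nothing = refl
... | nothing | _       = refl
eval-bin exp a b σ with eval a σ | eval b σ
... | just _  | just _  = refl
... | just _  | nothing = refl
... | nothing | _       = refl

eval-bin-cong : ∀ o (a b a′ b′ : Exp k) {σ τ} →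
  eval a σ ≡ eval a′ τ → eval b σ ≡ eval b′ τ →
  eval (binExp o a b) σ ≡ eval (binExp o a′ b′) τ
eval-bin-cong o a b a′ b′ {σ} {τ} ea eb = begin
  eval (binExp o a b) σ                      ≡⟨ eval-bin o a b σ ⟩
  both (binVal o) (eval a σ) (eval b σ)      ≡⟨ cong₂ (both (binVal o)) ea eb ⟩
  both (binVal o) (eval a′ τ) (eval b′ τ)    ≡⟨ sym (eval-bin o a′ b′ τ) ⟩
  eval (binExp o a′ b′) τ                    ∎
  where open ≡-Reasoning

eval-⊕-inv : ∀ (a b : Exp k) σ {q} → eval (a ⊕ b) σ ≡ just q →
  ∃ λ p → ∃ λ r → eval a σ ≡ just p × eval b σ ≡ just r × q ≡ p ℚ.+ r
eval-⊕-inv a b σ eq = inv (eval a σ) (eval b σ) (trans (sym (eval-bin add a b σ)) eq)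
  where
  inv : ∀ u v {q} → both (binVal add) u v ≡ just q →
        ∃ λ p → ∃ λ r → u ≡ just p × v ≡ just r × q ≡ p ℚ.+ r
  inv (just p) (just r) refl = p , r , refl , refl , refl

record Composite (μ : PSubst k) (σ σ′ : IntSubst k) : Set where
  field
    on-program   : ∀ i → eval (μ i) σ ≡ just (ι (σ′ (x i)))
    on-temporary : ∀ j → σ (inj₂ j) ≡ σ′ (inj₂ j)

composite : (μ : PSubst k) (σ : IntSubst k) →
  (∀ i → IsInt (eval (μ i) σ)) → Σ (IntSubst k) (Composite μ σ)
composite μ σ int = σ′ , record { on-program = λ i → proj₂ (int i) ; on-temporary = λ _ → refl }
  where
  σ′ : IntSubst _
  σ′ (inj₁ i) = proj₁ (int i)
  σ′ (inj₂ j) = σ (inj₂ j)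

module Substitution {μ : PSubst k} {σ σ′ : IntSubst k} (comp : Composite μ σ σ′) where
  open Composite comp

  eval-subst : ∀ e → eval (e ⟪ μ ⟫) σ ≡ eval e σ′
  eval-subst (var (inj₁ i)) = on-program i
  eval-subst (var (inj₂ j)) = cong (λ z → just (ι z)) (on-temporary j)
  eval-subst (num z)        = refl
  eval-subst (a ⊕ b)        = eval-bin-cong add (a ⟪ μ ⟫) (b ⟪ μ ⟫) a b (eval-subst a) (eval-subst b)
  eval-subst (a ⊖ b)        = eval-bin-cong sub (a ⟪ μ ⟫) (b ⟪ μ ⟫) a b (eval-subst a) (eval-subst b)
  eval-subst (a ⊗ b)        = eval-bin-cong mul (a ⟪ μ ⟫) (b ⟪ μ ⟫) a b (eval-subst a) (eval-subst b)
  eval-subst (a ⊘ b)        = eval-bin-cong div (a ⟪ μ ⟫) (b ⟪ μ ⟫) a b (eval-subst a) (eval-subst b)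
  eval-subst (a ⊛ b)        = eval-bin-cong exp (a ⟪ μ ⟫) (b ⟪ μ ⟫) a b (eval-subst a) (eval-subst b)

  models-subst : ∀ φ → σ ⊨ substConstraint φ μ → σ′ ⊨ φ
  models-subst []                []                                  = []
  models-subst (ineq a o b ∷ φ) ((p , q , ea , eb , holds) ∷ rest) =
    (p , q , trans (sym (eval-subst a)) ea , trans (sym (eval-subst b)) eb , holds)
    ∷ models-subst φ rest

  arg-subst : ∀ (t : Term m k) i →
    eval (lookup (proj₂ (substTerm t μ)) i) σ ≡ eval (lookup (proj₂ t) i) σ′
  arg-subst (g , ts) i = trans (cong (λ e → eval e σ) (lookup-map i (_⟪ μ ⟫) ts)) (eval-subst (lookup ts i))

  term-subst : ∀ (t : Term m k) v → EvalTerm σ (substTerm t μ) v → EvalTerm σ′ t v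
  term-subst t v (g≡h , args) = g≡h , λ i → trans (sym (arg-subst t i)) (args i)

  lhs-subst : ∀ (f : Fin m) → EvalTerm σ (applyLhs f μ) (f , tabulate (λ i → σ′ (x i)))
  lhs-subst f = refl , λ i → begin
    eval (lookup (tabulate μ) i) σ   ≡⟨ cong (λ e → eval e σ) (lookup∘tabulate μ i) ⟩
    eval (μ i) σ                     ≡⟨ on-program i ⟩
    just (ι (σ′ (x i)))              ≡⟨ cong (λ z → just (ι z)) (sym (lookup∘tabulate (λ i → σ′ (x i)) i)) ⟩
    just (ι (lookup (tabulate (λ i → σ′ (x i))) i)) ∎
    where open ≡-Reasoning

module _ {P : Program m k} where

  step-steps : ∀ {S q T} → Step P S q T → Steps P S q T
  step-steps {q = q} s = subst (λ w → Steps P _ w _) (ℚP.+-identityʳ q) (more s done)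

  steps-++ : ∀ {S T U q r} → Steps P S q T → Steps P T r U → Steps P S (q ℚ.+ r) U
  steps-++ {r = r} done d = subst (λ w → Steps P _ w _) (sym (ℚP.+-identityˡ r)) d
  steps-++ {r = r} (more {q = q} {r = q′} s d) d′ =
    subst (λ w → Steps P _ w _) (sym (ℚP.+-assoc q q′ r)) (more s (steps-++ d d′))

simulate : {P P′ : Program m k} → (∀ {S q T} → Step P′ S q T → Steps P S q T) →
  ∀ {S q T} → Steps P′ S q T → Steps P S q T
simulate sim done       = done
simulate sim (more s d) = steps-++ (sim s) (simulate sim d)

sound-by-simulation : (f0 : Fin m) {P P′ : Program m k} →
  (∀ {S q T} → Steps P′ S q T → Steps P S q T) → SoundFor f0 P P′
sound-by-simulation f0 sim n a (ns , small , T , d) q q<a = a , (ns , small , T , sim d) , q<a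

module Chaining {P : Program m k} (wfP : WellFormed P)
  {f1 f2 : Fin m} {c1 c2 : Exp k} {μ : PSubst k} {t : Term m k} {φ1 φ2 : Constraint k}
  (α₁∈P : rule f1 c1 (applyLhs f2 μ ∷ []) φ1 ∈ P)
  (α₂∈P : rule f2 c2 (t ∷ []) φ2 ∈ P) where

  α₁₂ : Rule m k
  α₁₂ = chain f1 c1 φ1 μ c2 t φ2

  wf₁ : WellFormedRule (rule f1 c1 (applyLhs f2 μ ∷ []) φ1)
  wf₁ = All.lookup wfP α₁∈P

  wf₂ : WellFormedRule (rule f2 c2 (t ∷ []) φ2)
  wf₂ = All.lookup wfP α₂∈P

  composite-at : ∀ {σ} → σ ⊨ φ1 → Σ (IntSubst k) (Composite μ σ)
  composite-at {σ} g₁ = composite μ σ λ i →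
    subst (λ e → IsInt (eval e σ)) (lookup∘tabulate μ i) (All.head (wf₁ σ g₁) i)

  -- the arguments of tμ under σ are those of t under the composite σ′, which
  -- models φ₂ and hence makes them integral by well-formedness of α₂
  well-formed-chain : WellFormedRule α₁₂
  well-formed-chain σ g with ++⁻ φ1 g
  ... | g₁ , g₂ with composite-at g₁
  ... | σ′ , comp = (λ i → subst IsInt (sym (arg-subst t i)) (All.head (wf₂ σ′ (models-subst φ2 g₂)) i)) ∷ []
    where open Substitution comp

  -- every step of P ∪ {α₁.₂} is a derivation of P: an α₁.₂-step under σ is
  -- an α₁-step under σ followed by an α₂-step under σ′, costing c₁σ + c₂σ′
  chain-step : ∀ {S q T} → Step (α₁₂ ∷ P) S q T → Steps P S q T
  chain-step (step (there α∈P) perm hx g ce pw tp) = step-steps (step α∈P perm hx g ce pw tp)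
  chain-step (step {S′ = S′} {σ = σ} {Qv = v ∷ []} (here refl) perm hx g ce (ev ∷ []) tp)
    with ++⁻ φ1 g | eval-⊕-inv c1 (c2 ⟪ μ ⟫) σ ce
  ... | g₁ , g₂ | a , b , ea , eb , refl with composite-at g₁
  ... | σ′ , comp = steps-++ (step-steps first) (step-steps second)
    where
    open Substitution comp
    first : Step P _ a ((f2 , tabulate (λ i → σ′ (x i))) ∷ S′)
    first = step α₁∈P perm hx g₁ ea (lhs-subst f2 ∷ []) ↭-refl
    second : Step P ((f2 , tabulate (λ i → σ′ (x i))) ∷ S′) b _
    second = step α₂∈P ↭-refl (λ i → sym (lookup∘tabulate (λ i → σ′ (x i)) i))
      (models-subst φ2 g₂) (trans (sym (eval-subst c2)) eb) (term-subst t v ev ∷ []) tp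

theorem3p18 : (m k : ℕ) (f0 : Fin m) (P : Program m k) →
    IsIntegerProgram f0 P → WellFormed P → TailRecursive P →
    (f1 f2 : Fin m) (c1 c2 : Exp k) (μ : PSubst k) (t : Term m k) (φ1 φ2 : Constraint k) →
    rule f1 c1 (applyLhs f2 μ ∷ []) φ1 ∈ P →
    rule f2 c2 (t ∷ []) φ2 ∈ P →
    (∀ j → ¬ (InTV (rule f1 c1 (applyLhs f2 μ ∷ []) φ1) j × InTV (rule f2 c2 (t ∷ []) φ2) j)) →
    WellFormed (chain f1 c1 φ1 μ c2 t φ2 ∷ P)
    × SoundFor f0 P (chain f1 c1 φ1 μ c2 t φ2 ∷ P)
theorem3p18 m k f0 P _ wfP _ f1 f2 c1 c2 μ t φ1 φ2 α₁∈P α₂∈P _ =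
  (well-formed-chain ∷ wfP) , sound-by-simulation f0 (simulate chain-step)
  where open Chaining wfP α₁∈P α₂∈P
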